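{- Let $v\ge 2$, let $D\subseteq\mathbb{Z}_v$, and let $R=(R_{g,h})_{1\le g,h\le v}$ be the $v\times v$ binary circulant matrix with defining set $D$, i.e. $R_{g,h}=1$ if $(g-h)\bmod v\in D$ and $R_{g,h}=0$ otherwise. Then its aperiodic autocorrelation satisfies \[A_R(1,0)=A_R(-1,0)=A_R(0,1)=A_R(0,-1).\]
   Context: For an $M\times N$ binary matrix $R=(R_{i,j})$ with $1\le i\le M$, $1\le j\le N$, the 2D aperiodic autocorrelation at integer shifts $(\tau_1,\tau_2)$ is $A_R(\tau_1,\tau_2)=\sum_{i=1}^{M}\sum_{j=1}^{N}R_{i,j}R_{i+\tau_1,j+\tau_2}$, where entries $R_{i,j}$ with indices outside the range $1\le i\le M$, $1\le j\le N$ are taken to be $0$. -}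

module Defs where

open import Data.Nat using (ℕ; zero; suc; _+_; _*_; _∸_; _<?_)
open import Data.Nat.DivMod using (_mod_)
open import Data.Integer as ℤ using (ℤ; +_; -[1+_])
open import Data.Fin using (Fin; toℕ; fromℕ<)
open import Data.Fin.Subset using (Subset)
open import Data.Fin.Subset.Properties using (_∈?_)
open import Relation.Nullary using (yes; no)

sumFrom1 : ℕ → (ℕ → ℕ) → ℕ
sumFrom1 zero    f = 0
sumFrom1 (suc n) f = sumFrom1 n f + f (suc n)

-- A binary matrix of size M × N, with 0-based Fin indices internally
-- (Fin-index k corresponds to the paper's 1-based index k+1);
-- entries are natural numbers (0 or 1 for binary matrices).
Matrix : ℕ → ℕ → Set
Matrix M N = Fin M → Fin N → ℕ

-- Entry R_{i,j} with 1-based integer indices; 0 outside 1 ≤ i ≤ M, 1 ≤ j ≤ N.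
entry : ∀ {M N} → Matrix M N → ℤ → ℤ → ℕ
entry {M} {N} R (+ suc i) (+ suc j) with i <? M | j <? N
... | yes i<M | yes j<N = R (fromℕ< i<M) (fromℕ< j<N)
... | _       | _       = 0
entry R _ _ = 0

autocorr : ∀ {M N} → Matrix M N → ℤ → ℤ → ℕ
autocorr {M} {N} R τ₁ τ₂ =
  sumFrom1 M λ i → sumFrom1 N λ j →
    entry R (+ i) (+ j) * entry R (+ i ℤ.+ τ₁) (+ j ℤ.+ τ₂)

-- Binary circulant v × v matrix with defining set D ⊆ ℤ_v:
-- R_{g,h} = 1 if (g - h) mod v ∈ D, else 0.  (Fin-index k ↔ paper index k+1;
-- the shift of both indices by 1 does not change g - h.)
circulant : (v : ℕ) → Subset v → Matrix v v
circulant zero    D g h = 0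
circulant (suc n) D g h with ((toℕ g + suc n) ∸ toℕ h) mod (suc n) ∈? D
... | yes _ = 1
... | no  _ = 0

-- The autocorrelation is invariant under negating the shift, which gives
-- A(1,0) = A(-1,0) and A(0,1) = A(0,-1) for every matrix.  A circulant matrix
-- is persymmetric (R(g,h) = R(v+1-h, v+1-g), since g - h is preserved), and
-- the anti-transposition (i,j) ↦ (v+1-j, v+1-i) carries horizontally adjacent
-- pairs to vertically adjacent ones; reindexing the double sum along it turns
-- A(0,1) into A(-1,0).
module Submission where

open import Defs
open import Data.Nat using (ℕ; zero; suc; _+_; _*_; _∸_; _≤_; _<_; _<?_; s≤s)
open import Data.Nat.Properties
open import Data.Nat.DivMod using (_mod_)
open import Algebra.Properties.CommutativeSemigroup +-commutativeSemigroup using (interchange)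
open import Data.Integer using (+_; -_)
import Data.Integer as ℤ
open import Data.Fin using (toℕ; fromℕ<; opposite)
open import Data.Fin.Properties using (toℕ-fromℕ<; toℕ-injective; toℕ≤pred[n]; opposite-prop)
open import Data.Fin.Subset using (Subset)
open import Data.Fin.Subset.Properties using (_∈?_)
open import Data.Product using (_×_; _,_)
open import Function using (_∘_)
open import Relation.Nullary using (yes; no; contradiction)
open import Relation.Binary.PropositionalEquality
  using (_≡_; refl; sym; trans; cong; cong₂; _≗_; module ≡-Reasoning)
open ≡-Reasoning

∑< : ℕ → (ℕ → ℕ) → ℕ
∑< zero    f = 0
∑< (suc n) f = ∑< n f + f n

infix 5 ∑<
syntax ∑< n (λ i → e) = ∑[ i < n ] e

sumFrom1≡∑< : ∀ n f → sumFrom1 n f ≡ ∑[ i < n ] f (suc i)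
sumFrom1≡∑< zero    f = refl
sumFrom1≡∑< (suc n) f = cong (_+ f (suc n)) (sumFrom1≡∑< n f)

∑<-cong : ∀ n {f g : ℕ → ℕ} → (∀ i → i < n → f i ≡ g i) → ∑< n f ≡ ∑< n g
∑<-cong zero    eq = refl
∑<-cong (suc n) eq = cong₂ _+_ (∑<-cong n (λ i i<n → eq i (m<n⇒m<1+n i<n))) (eq n ≤-refl)

∑<-cong-≗ : ∀ n {f g : ℕ → ℕ} → f ≗ g → ∑< n f ≡ ∑< n g
∑<-cong-≗ n eq = ∑<-cong n (λ i _ → eq i)

∑<-zero : ∀ n {f : ℕ → ℕ} → (∀ i → f i ≡ 0) → ∑< n f ≡ 0
∑<-zero zero    eq = refl
∑<-zero (suc n) eq = cong₂ _+_ (∑<-zero n eq) (eq n)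

∑<-head : ∀ n f → ∑< (suc n) f ≡ f 0 + (∑[ i < n ] f (suc i))
∑<-head zero    f = +-comm 0 (f 0)
∑<-head (suc n) f = trans (cong (_+ f (suc n)) (∑<-head n f)) (+-assoc (f 0) _ _)

∑<-distrib : ∀ n f g → (∑[ i < n ] f i + g i) ≡ ∑< n f + ∑< n g
∑<-distrib zero    f g = refl
∑<-distrib (suc n) f g =
  trans (cong (_+ (f n + g n)) (∑<-distrib n f g)) (interchange (∑< n f) (∑< n g) (f n) (g n))

∑<-swap : ∀ m n (f : ℕ → ℕ → ℕ) →
  ∑[ i < m ] ∑[ j < n ] f i j ≡ ∑[ j < n ] ∑[ i < m ] f i j
∑<-swap zero    n f = sym (∑<-zero n (λ _ → refl))
∑<-swap (suc m) n f = begin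
  (∑[ i < m ] ∑[ j < n ] f i j) + (∑[ j < n ] f m j)   ≡⟨ cong (_+ ∑< n (f m)) (∑<-swap m n f) ⟩
  (∑[ j < n ] ∑[ i < m ] f i j) + (∑[ j < n ] f m j)   ≡⟨ ∑<-distrib n _ (f m) ⟨
  (∑[ j < n ] ∑[ i < suc m ] f i j)                    ∎

∑<-reverse : ∀ n f → ∑< n f ≡ ∑[ i < n ] f (n ∸ suc i)
∑<-reverse zero    f = refl
∑<-reverse (suc n) f = begin
  ∑< (suc n) f                                   ≡⟨ ∑<-head n f ⟩
  f 0 + (∑[ i < n ] f (suc i))                   ≡⟨ +-comm (f 0) _ ⟩
  (∑[ i < n ] f (suc i)) + f 0                   ≡⟨ cong₂ _+_ (∑<-reverse n (f ∘ suc)) (cong f (sym (n∸n≡0 n))) ⟩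
  (∑[ i < n ] f (suc (n ∸ suc i))) + f (n ∸ n)   ≡⟨ cong (_+ f (n ∸ n)) (∑<-cong n (λ i i<n → cong f (sym (+-∸-assoc 1 i<n)))) ⟩
  (∑[ i < n ] f (n ∸ i)) + f (n ∸ n)             ∎

∑<-shift : ∀ n f → f 0 ≡ 0 → f n ≡ 0 → ∑[ i < n ] f (suc i) ≡ ∑< n f
∑<-shift n f f0≡0 fn≡0 = begin
  ∑[ i < n ] f (suc i)          ≡⟨ cong (_+ ∑< n (f ∘ suc)) f0≡0 ⟨
  f 0 + (∑[ i < n ] f (suc i))  ≡⟨ ∑<-head n f ⟨
  ∑< n f + f n                ≡⟨ cong (λ x → ∑< n f + x) fn≡0 ⟩
  ∑< n f + 0                  ≡⟨ +-identityʳ (∑< n f) ⟩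
  ∑< n f                      ∎

∑<-antitranspose : ∀ m n (f : ℕ → ℕ → ℕ) →
  ∑[ i < m ] ∑[ j < n ] f i j ≡ ∑[ i < n ] ∑[ j < m ] f (m ∸ suc j) (n ∸ suc i)
∑<-antitranspose m n f = begin
  ∑[ i < m ] ∑[ j < n ] f i j                          ≡⟨ ∑<-swap m n f ⟩
  ∑[ j < n ] ∑[ i < m ] f i j                          ≡⟨ ∑<-reverse n _ ⟩
  ∑[ j < n ] ∑[ i < m ] f i (n ∸ suc j)                ≡⟨ ∑<-cong-≗ n (λ j → ∑<-reverse m _) ⟩
  ∑[ j < n ] ∑[ i < m ] f (m ∸ suc i) (n ∸ suc j)      ∎

module _ {M N : ℕ} (R : Matrix M N) where

  entry₀ : ℕ → ℕ → ℕ
  entry₀ i j = entry R (+ suc i) (+ suc j)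

  entry₀-fromℕ< : ∀ {i j} (i<M : i < M) (j<N : j < N) → entry₀ i j ≡ R (fromℕ< i<M) (fromℕ< j<N)
  entry₀-fromℕ< {i} {j} i<M j<N with i <? M | j <? N
  ... | yes _   | yes _   = refl
  ... | yes _   | no j≮N  = contradiction j<N j≮N
  ... | no i≮M  | _       = contradiction i<M i≮M

  entry₀-rowOut : ∀ {i} j → M ≤ i → entry₀ i j ≡ 0
  entry₀-rowOut {i} j M≤i with i <? M | j <? N
  ... | yes i<M | yes _ = contradiction i<M (≤⇒≯ M≤i)
  ... | yes _   | no _  = refl
  ... | no _    | _     = refl

  entry₀-colOut : ∀ i {j} → N ≤ j → entry₀ i j ≡ 0
  entry₀-colOut i {j} N≤j with i <? M | j <? N
  ... | yes _ | yes j<N = contradiction j<N (≤⇒≯ N≤j)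
  ... | yes _ | no _    = refl
  ... | no _  | _       = refl

  autocorr-∑< : ∀ τ₁ τ₂ → autocorr R τ₁ τ₂ ≡
    ∑[ i < M ] ∑[ j < N ] entry₀ i j * entry R (+ suc i ℤ.+ τ₁) (+ suc j ℤ.+ τ₂)
  autocorr-∑< τ₁ τ₂ = trans (sumFrom1≡∑< M _) (∑<-cong-≗ M (λ i → sumFrom1≡∑< N _))

  private
    entryAt : ∀ {a b c d} → a ≡ c → b ≡ d → entry R (+ a) (+ b) ≡ entry R (+ c) (+ d)
    entryAt = cong₂ (λ a b → entry R (+ a) (+ b))

  autocorr[1,0] : autocorr R (+ 1) (+ 0) ≡ ∑[ i < M ] ∑[ j < N ] entry₀ i j * entry₀ (suc i) j
  autocorr[1,0] = trans (autocorr-∑< (+ 1) (+ 0)) (∑<-cong-≗ M λ i → ∑<-cong-≗ N λ j →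
    cong (entry₀ i j *_) (entryAt (+-comm (suc i) 1) (+-identityʳ (suc j))))

  -- + suc i ℤ.+ - (+ 1) reduces to + i, so only the column index needs rewriting.
  autocorr[-1,0] : autocorr R (- (+ 1)) (+ 0) ≡ ∑[ i < M ] ∑[ j < N ] entry₀ i j * entry R (+ i) (+ suc j)
  autocorr[-1,0] = trans (autocorr-∑< (- (+ 1)) (+ 0)) (∑<-cong-≗ M λ i → ∑<-cong-≗ N λ j →
    cong (entry₀ i j *_) (entryAt {c = i} refl (+-identityʳ (suc j))))

  autocorr[0,1] : autocorr R (+ 0) (+ 1) ≡ ∑[ i < M ] ∑[ j < N ] entry₀ i j * entry₀ i (suc j)
  autocorr[0,1] = trans (autocorr-∑< (+ 0) (+ 1)) (∑<-cong-≗ M λ i → ∑<-cong-≗ N λ j →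
    cong (entry₀ i j *_) (entryAt (+-identityʳ (suc i)) (+-comm (suc j) 1)))

  autocorr[0,-1] : autocorr R (+ 0) (- (+ 1)) ≡ ∑[ i < M ] ∑[ j < N ] entry₀ i j * entry R (+ suc i) (+ j)
  autocorr[0,-1] = trans (autocorr-∑< (+ 0) (- (+ 1))) (∑<-cong-≗ M λ i → ∑<-cong-≗ N λ j →
    cong (entry₀ i j *_) (entryAt {d = j} (+-identityʳ (suc i)) refl))

  -- Index 0 is outside the matrix, so each sum below is a shifted copy of a
  -- sum vanishing at both ends.
  autocorr[1,0]≡autocorr[-1,0] : autocorr R (+ 1) (+ 0) ≡ autocorr R (- (+ 1)) (+ 0)
  autocorr[1,0]≡autocorr[-1,0] = begin
    autocorr R (+ 1) (+ 0)                                   ≡⟨ autocorr[1,0] ⟩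
    ∑[ i < M ] rowPair (suc i)                               ≡⟨ ∑<-shift M rowPair (∑<-zero N (λ _ → refl)) lastRowPair ⟩
    ∑[ i < M ] rowPair i                                     ≡⟨ ∑<-cong-≗ M (λ i → ∑<-cong-≗ N (λ j → *-comm _ (entry₀ i j))) ⟩
    ∑[ i < M ] ∑[ j < N ] entry₀ i j * entry R (+ i) (+ suc j) ≡⟨ autocorr[-1,0] ⟨
    autocorr R (- (+ 1)) (+ 0)                               ∎
    where
    rowPair : ℕ → ℕ
    rowPair i = ∑[ j < N ] entry R (+ i) (+ suc j) * entry₀ i j

    lastRowPair : rowPair M ≡ 0
    lastRowPair = ∑<-zero N λ j →
      trans (cong (entry R (+ M) (+ suc j) *_) (entry₀-rowOut j ≤-refl)) (*-zeroʳ (entry R (+ M) (+ suc j)))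

  autocorr[0,1]≡autocorr[0,-1] : autocorr R (+ 0) (+ 1) ≡ autocorr R (+ 0) (- (+ 1))
  autocorr[0,1]≡autocorr[0,-1] = begin
    autocorr R (+ 0) (+ 1)                                   ≡⟨ autocorr[0,1] ⟩
    ∑[ i < M ] ∑[ j < N ] colPair i (suc j)                  ≡⟨ ∑<-cong-≗ M (λ i → ∑<-shift N (colPair i) refl (lastColPair i)) ⟩
    ∑[ i < M ] ∑[ j < N ] colPair i j                        ≡⟨ ∑<-cong-≗ M (λ i → ∑<-cong-≗ N (λ j → *-comm _ (entry₀ i j))) ⟩
    ∑[ i < M ] ∑[ j < N ] entry₀ i j * entry R (+ suc i) (+ j) ≡⟨ autocorr[0,-1] ⟨
    autocorr R (+ 0) (- (+ 1))                               ∎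
    where
    colPair : ℕ → ℕ → ℕ
    colPair i j = entry R (+ suc i) (+ j) * entry₀ i j

    lastColPair : ∀ i → colPair i N ≡ 0
    lastColPair i =
      trans (cong (entry R (+ suc i) (+ N) *_) (entry₀-colOut i ≤-refl)) (*-zeroʳ (entry R (+ suc i) (+ N)))

Persymmetric : ∀ {v} → Matrix v v → Set
Persymmetric R = ∀ g h → R (opposite h) (opposite g) ≡ R g h

module _ {n : ℕ} {R : Matrix (suc n) (suc n)} (persym : Persymmetric R) where

  entry₀-persymmetric : ∀ {i j} → i ≤ n → j ≤ n → entry₀ R (n ∸ j) (n ∸ i) ≡ entry₀ R i j
  entry₀-persymmetric {i} {j} i≤n j≤n = begin
    entry₀ R (n ∸ j) (n ∸ i)                       ≡⟨ entry₀-fromℕ< R (s≤s (m∸n≤m n j)) (s≤s (m∸n≤m n i)) ⟩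
    R (fromℕ< _) (fromℕ< _)                        ≡⟨ cong₂ R (fromℕ<-opposite j≤n) (fromℕ<-opposite i≤n) ⟩
    R (opposite (fromℕ< (s≤s j≤n))) (opposite (fromℕ< (s≤s i≤n))) ≡⟨ persym _ _ ⟩
    R (fromℕ< (s≤s i≤n)) (fromℕ< (s≤s j≤n))        ≡⟨ entry₀-fromℕ< R (s≤s i≤n) (s≤s j≤n) ⟨
    entry₀ R i j                                   ∎
    where
    fromℕ<-opposite : ∀ {k} (k≤n : k ≤ n) →
      fromℕ< (s≤s (m∸n≤m n k)) ≡ opposite (fromℕ< {k} {suc n} (s≤s k≤n))
    fromℕ<-opposite {k} k≤n = toℕ-injective (begin
      toℕ (fromℕ< (s≤s (m∸n≤m n k)))          ≡⟨ toℕ-fromℕ< (s≤s (m∸n≤m n k)) ⟩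
      n ∸ k                                   ≡⟨ cong (n ∸_) (toℕ-fromℕ< (s≤s k≤n)) ⟨
      n ∸ toℕ (fromℕ< {k} {suc n} (s≤s k≤n))  ≡⟨ opposite-prop (fromℕ< (s≤s k≤n)) ⟨
      toℕ (opposite (fromℕ< (s≤s k≤n)))       ∎)

  -- entry R (+ i) (+ suc j) is entry₀ R (i - 1) j, and 0 for i = 0.
  entry₀-antitransposed-step : ∀ {i j} → i ≤ n → j ≤ n →
    entry₀ R (n ∸ j) (suc (n ∸ i)) ≡ entry R (+ i) (+ suc j)
  entry₀-antitransposed-step {zero}  {j} _ _ = entry₀-colOut R (n ∸ j) ≤-refl
  entry₀-antitransposed-step {suc i} {j} i<n j≤n = begin
    entry₀ R (n ∸ j) (suc (n ∸ suc i))   ≡⟨ cong (entry₀ R (n ∸ j)) (+-∸-assoc 1 i<n) ⟨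
    entry₀ R (n ∸ j) (n ∸ i)             ≡⟨ entry₀-persymmetric (<⇒≤ i<n) j≤n ⟩
    entry₀ R i j                         ∎

  autocorr[0,1]≡autocorr[-1,0] : autocorr R (+ 0) (+ 1) ≡ autocorr R (- (+ 1)) (+ 0)
  autocorr[0,1]≡autocorr[-1,0] = begin
    autocorr R (+ 0) (+ 1)                                               ≡⟨ autocorr[0,1] R ⟩
    ∑[ i < suc n ] ∑[ j < suc n ] entry₀ R i j * entry₀ R i (suc j)      ≡⟨ ∑<-antitranspose (suc n) (suc n) _ ⟩
    ∑[ i < suc n ] ∑[ j < suc n ] antitransposedTerm i j                 ≡⟨ ∑<-cong (suc n) (λ i i<v →
                                                                              ∑<-cong (suc n) (λ j j<v → antitransposedTerm≡ i<v j<v)) ⟩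
    ∑[ i < suc n ] ∑[ j < suc n ] entry₀ R i j * entry R (+ i) (+ suc j) ≡⟨ autocorr[-1,0] R ⟨
    autocorr R (- (+ 1)) (+ 0)                                           ∎
    where
    antitransposedTerm : ℕ → ℕ → ℕ
    antitransposedTerm i j = entry₀ R (n ∸ j) (n ∸ i) * entry₀ R (n ∸ j) (suc (n ∸ i))

    antitransposedTerm≡ : ∀ {i j} → i < suc n → j < suc n →
      antitransposedTerm i j ≡ entry₀ R i j * entry R (+ i) (+ suc j)
    antitransposedTerm≡ (s≤s i≤n) (s≤s j≤n) =
      cong₂ _*_ (entry₀-persymmetric i≤n j≤n) (entry₀-antitransposed-step i≤n j≤n)

[n∸j+w]∸[n∸i]≡i+w∸j : ∀ {n i j} w → i ≤ n → j ≤ n → n ∸ j + w ∸ (n ∸ i) ≡ i + w ∸ j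
[n∸j+w]∸[n∸i]≡i+w∸j {n} {i} {j} w i≤n j≤n = begin
  n ∸ j + w ∸ (n ∸ i)         ≡⟨ cong (_∸ (n ∸ i)) (+-∸-comm w j≤n) ⟨
  n + w ∸ j ∸ (n ∸ i)         ≡⟨ ∸-+-assoc (n + w) j (n ∸ i) ⟩
  n + w ∸ (j + (n ∸ i))       ≡⟨ cong (n + w ∸_) (+-comm j (n ∸ i)) ⟩
  n + w ∸ (n ∸ i + j)         ≡⟨ ∸-+-assoc (n + w) (n ∸ i) j ⟨
  n + w ∸ (n ∸ i) ∸ j         ≡⟨ cong (_∸ j) (+-∸-comm w (m∸n≤m n i)) ⟩
  n ∸ (n ∸ i) + w ∸ j         ≡⟨ cong (λ k → k + w ∸ j) (m∸[m∸n]≡n i≤n) ⟩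
  i + w ∸ j                   ∎

circulantValue : ∀ {n} → Subset (suc n) → ℕ → ℕ
circulantValue {n} D d with d mod suc n ∈? D
... | yes _ = 1
... | no _  = 0

circulant≡circulantValue : ∀ n D g h → circulant (suc n) D g h ≡ circulantValue D (toℕ g + suc n ∸ toℕ h)
circulant≡circulantValue n D g h with (toℕ g + suc n ∸ toℕ h) mod suc n ∈? D
... | yes _ = refl
... | no _  = refl

circulant-persymmetric : ∀ v (D : Subset v) → Persymmetric (circulant v D)
circulant-persymmetric (suc n) D g h = begin
  circulant (suc n) D (opposite h) (opposite g)                            ≡⟨ circulant≡circulantValue n D _ _ ⟩
  circulantValue D (toℕ (opposite h) + suc n ∸ toℕ (opposite g))           ≡⟨ cong (circulantValue D) (cong₂ (λ a b → a + suc n ∸ b) (opposite-prop h) (opposite-prop g)) ⟩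
  circulantValue D (n ∸ toℕ h + suc n ∸ (n ∸ toℕ g))                       ≡⟨ cong (circulantValue D) ([n∸j+w]∸[n∸i]≡i+w∸j (suc n) (toℕ≤pred[n] g) (toℕ≤pred[n] h)) ⟩
  circulantValue D (toℕ g + suc n ∸ toℕ h)                                 ≡⟨ circulant≡circulantValue n D g h ⟨
  circulant (suc n) D g h                                                  ∎

mainTheorem2 : (v : ℕ) → 2 ≤ v → (D : Subset v) →
    (autocorr (circulant v D) (+ 1) (+ 0) ≡ autocorr (circulant v D) (- (+ 1)) (+ 0))
    × (autocorr (circulant v D) (- (+ 1)) (+ 0) ≡ autocorr (circulant v D) (+ 0) (+ 1))
    × (autocorr (circulant v D) (+ 0) (+ 1) ≡ autocorr (circulant v D) (+ 0) (- (+ 1)))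
mainTheorem2 (suc n) _ D =
  autocorr[1,0]≡autocorr[-1,0] R ,
  sym (autocorr[0,1]≡autocorr[-1,0] (circulant-persymmetric (suc n) D)) ,
  autocorr[0,1]≡autocorr[0,-1] R
  where R = circulant (suc n) D
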